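{- Let $n\geq 2$ and let $(F_0,F_1,F_2,F_3)$ be a type-I 2-factorization of $\vec{C}_n\wr\vec{C}_3$, where for $j\in\{0,1,2\}$ the type-1 2-factor $F_j$ contains the arc $(0_j,0_{j+1})$ and $F_3$ is the type-0 2-factor. For $i\in\mathbb{Z}_n$ and $j\in\{0,1,2\}$ let $k_{(i,j)}\in\mathbb{Z}_3$ be such that $F_j$ contains the arc $(i_{k_{(i,j)}}, i_{k_{(i,j)}+1})$, and let $\sigma_i$ be the permutation of $\mathbb{Z}_3$ defined by $(k_{(i,j)})^{\sigma_i}=k_{(i+1,j)}$ (first index modulo $n$). Then $\sigma_0\sigma_1\cdots\sigma_{n-1}$ is the identity permutation.
   Context: Let $V(\vec{C}_n)=\mathbb{Z}_n$ with arcs $(i,i+1)$ and $V(\vec{C}_3)=\mathbb{Z}_3$ with arcs $(j,j+1)$; $\vec{C}_n\wr\vec{C}_3$ has vertex set $\mathbb{Z}_n\times\mathbb{Z}_3$, with $((g_1,h_1),(g_2,h_2))$ an arc iff $g_2=g_1+1$, or $g_1=g_2$ and $h_2=h_1+1$. Write $i_j$ for $(i,j)$ and $C^i_3$ for the directed 3-cycle $i_0\,i_1\,i_2\,i_0$. A directed 2-factor is a spanning subdigraph that is a vertex-disjoint union of directed cycles; it is of type $k$ if it contains exactly $k$ arcs of $C^i_3$ for every $i\in\mathbb{Z}_n$. A type-I 2-factorization of $\vec{C}_n\wr\vec{C}_3$ is a partition of its arc set into four directed 2-factors, three of type 1 and one of type 0. Permutations act on the right and are composed left to right: $j^{\alpha\beta}=(j^\alpha)^\beta$.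 -}

module Defs where

open import Data.Nat using (ℕ; zero; suc)
open import Data.Nat.DivMod using (_%_; m%n<n)
open import Data.Fin using (Fin; toℕ; fromℕ<)
open import Data.Product using (Σ; _×_; _,_)
open import Data.List using (foldl; allFin)
open import Relation.Binary.PropositionalEquality using (_≡_)
open import Relation.Nullary using (¬_)

sucMod : ∀ {n} → Fin n → Fin n
sucMod {suc m} i = fromℕ< (m%n<n (suc (toℕ i)) (suc m))

-- vertices of C_n ≀ C_3 : i_j = (i , j)
Vertex : ℕ → Set
Vertex n = Fin n × Fin 3

-- arcs of C_n ≀ C_3 (for n ≥ 2 these are in bijection with the arc set):
--   cross i a b : (i_a , (i+1)_b)
--   inner i a   : (i_a , i_{a+1})   (the arcs of C^i_3)
data Arc (n : ℕ) : Set where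
  cross : Fin n → Fin 3 → Fin 3 → Arc n
  inner : Fin n → Fin 3 → Arc n

tail : ∀ {n} → Arc n → Vertex n
tail (cross i a b) = i , a
tail (inner i a)   = i , a

head : ∀ {n} → Arc n → Vertex n
head (cross i a b) = sucMod i , b
head (inner i a)   = i , sucMod a

ExactlyOne : (A : Set) → (A → Set) → Set
ExactlyOne A P = Σ A (λ a → P a × (∀ b → P b → b ≡ a))

-- a spanning subdigraph (given by its arc set S) is a directed 2-factor
-- (vertex-disjoint union of directed cycles covering all vertices) iff every
-- vertex has exactly one outgoing and exactly one incoming arc in S
IsDirected2Factor : ∀ n → (Arc n → Set) → Set
IsDirected2Factor n S =
  ∀ (v : Vertex n) →
    ExactlyOne (Arc n) (λ e → S e × tail e ≡ v) ×
    ExactlyOne (Arc n) (λ e → S e × head e ≡ v)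

IsType1 : ∀ n → (Arc n → Set) → Set
IsType1 n S = ∀ (i : Fin n) → ExactlyOne (Fin 3) (λ a → S (inner i a))

IsType0 : ∀ n → (Arc n → Set) → Set
IsType0 n S = ∀ (i : Fin n) (a : Fin 3) → ¬ S (inner i a)

-- a partition of the arc set into four classes F_0..F_3, given by a colouring
ColourClass : ∀ {n} → (Arc n → Fin 4) → Fin 4 → Arc n → Set
ColourClass c t e = c e ≡ t

-- right action, left-to-right composition: x^{σ_0 σ_1 ⋯ σ_{n-1}}
applyProduct : ∀ {n} → (Fin n → Fin 3 → Fin 3) → Fin 3 → Fin 3
applyProduct {n} σ x = foldl (λ y i → σ i y) x (allFin n)

-- Since σ_i sends k_(i,j) to k_(i+1,j), the product σ_0 σ_1 ⋯ σ_{n-1}, applied along the orbit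
-- 0, 1, …, n-1 of the cyclic successor, sends k_(0,j) to k_(n,j) = k_(0,j). And k_(0,j) = j,
-- because F_j contains the arc (0_j, 0_{j+1}) and exactly one arc of C^0_3.
module Submission where

open import Defs
open import Data.Nat using (ℕ; suc; _+_; _%_)
open import Data.Nat.DivMod using (m%n%n≡m%n; %-distribˡ-+; m<n⇒m%n≡m; n%n≡0)
open import Data.Nat.Properties using (+-comm)
open import Data.Nat.GeneralisedArithmetic using (fold; iterate; iterate-is-fold)
open import Data.Fin using (Fin; zero; inject₁; fromℕ; toℕ)
open import Data.Fin.Properties using (toℕ-injective; toℕ-fromℕ<; toℕ<n)
open import Data.Product using (_,_)
open import Data.List as List using (foldl; tabulate; allFin)
open import Data.List.Properties using (tabulate-cong)
open import Relation.Binary.PropositionalEquality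
  using (_≡_; refl; sym; trans; cong; subst; module ≡-Reasoning)

open ≡-Reasoning

ExactlyOne-unique : ∀ {A : Set} {P : A → Set} → ExactlyOne A P →
                    ∀ {a b} → P a → P b → a ≡ b
ExactlyOne-unique (_ , _ , unique) Pa Pb = trans (unique _ Pa) (sym (unique _ Pb))

tabulate-iterate : ∀ {A : Set} (f : A → A) (x : A) n →
                   tabulate (λ (i : Fin n) → iterate f x (toℕ i)) ≡ List.iterate f x n
tabulate-iterate f x ℕ.zero  = refl
tabulate-iterate f x (suc n) = cong (x List.∷_) (tabulate-iterate f (f x) n)

module _ {I B : Set} (s : I → I) (k σ : I → B → B)
         (intertwines : ∀ i b → σ i (k i b) ≡ k (s i) b) where

  foldl-intertwines-iterate : ∀ i r b →
    foldl (λ y i → σ i y) (k i b) (List.iterate s i r) ≡ k (iterate s i r) b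
  foldl-intertwines-iterate i ℕ.zero  b = refl
  foldl-intertwines-iterate i (suc r) b = begin
    foldl (λ y i → σ i y) (σ i (k i b)) (List.iterate s (s i) r)
      ≡⟨ cong (λ y → foldl (λ y i → σ i y) y (List.iterate s (s i) r)) (intertwines i b) ⟩
    foldl (λ y i → σ i y) (k (s i) b) (List.iterate s (s i) r)
      ≡⟨ foldl-intertwines-iterate (s i) r b ⟩
    k (iterate s (s i) r) b ∎

module _ {m : ℕ} where

  private
    n = suc m

  toℕ-sucMod : ∀ (i : Fin n) → toℕ (sucMod i) ≡ suc (toℕ i) % n
  toℕ-sucMod i = toℕ-fromℕ< _

  -- fold (unlike iterate) applies the new sucMod outermost, which is what the induction needs.
  toℕ-fold-sucMod : ∀ r → toℕ (fold zero (sucMod {n}) r) ≡ r % n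
  toℕ-fold-sucMod ℕ.zero  = refl
  toℕ-fold-sucMod (suc r) = begin
    toℕ (sucMod (fold zero sucMod r))  ≡⟨ toℕ-sucMod _ ⟩
    suc (toℕ (fold zero sucMod r)) % n ≡⟨ cong (λ t → suc t % n) (toℕ-fold-sucMod r) ⟩
    suc (r % n) % n                    ≡⟨ cong (_% n) (+-comm 1 (r % n)) ⟩
    (r % n + 1) % n                    ≡⟨ %-distribˡ-+ (r % n) 1 n ⟩
    (r % n % n + 1 % n) % n            ≡⟨ cong (λ t → (t + 1 % n) % n) (m%n%n≡m%n r n) ⟩
    (r % n + 1 % n) % n                ≡⟨ sym (%-distribˡ-+ r 1 n) ⟩
    (r + 1) % n                        ≡⟨ cong (_% n) (+-comm r 1) ⟩
    suc r % n                          ∎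

  toℕ-iterate-sucMod : ∀ r → toℕ (iterate (sucMod {n}) zero r) ≡ r % n
  toℕ-iterate-sucMod r = trans (cong toℕ (sym (iterate-is-fold zero sucMod r))) (toℕ-fold-sucMod r)

  iterate-sucMod-toℕ : ∀ (i : Fin n) → iterate sucMod zero (toℕ i) ≡ i
  iterate-sucMod-toℕ i = toℕ-injective (trans (toℕ-iterate-sucMod (toℕ i)) (m<n⇒m%n≡m (toℕ<n i)))

  iterate-sucMod-period : iterate (sucMod {n}) zero n ≡ zero
  iterate-sucMod-period = toℕ-injective (trans (toℕ-iterate-sucMod n) (n%n≡0 n))

  allFin≡orbit-sucMod : allFin n ≡ List.iterate sucMod zero n
  allFin≡orbit-sucMod = begin
    tabulate (λ i → i)                           ≡⟨ sym (tabulate-cong iterate-sucMod-toℕ) ⟩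
    tabulate (λ i → iterate sucMod zero (toℕ i)) ≡⟨ tabulate-iterate sucMod zero n ⟩
    List.iterate sucMod zero n                   ∎

  applyProduct-intertwines : ∀ (k σ : Fin n → Fin 3 → Fin 3) →
    (∀ i b → σ i (k i b) ≡ k (sucMod i) b) →
    ∀ b → applyProduct σ (k zero b) ≡ k zero b
  applyProduct-intertwines k σ intertwines b = begin
    foldl (λ y i → σ i y) (k zero b) (allFin n)
      ≡⟨ cong (foldl (λ y i → σ i y) (k zero b)) allFin≡orbit-sucMod ⟩
    foldl (λ y i → σ i y) (k zero b) (List.iterate sucMod zero n)
      ≡⟨ foldl-intertwines-iterate sucMod k σ intertwines zero n b ⟩
    k (iterate sucMod zero n) b
      ≡⟨ cong (λ i → k i b) iterate-sucMod-period ⟩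
    k zero b ∎

corollary6p14 : ∀ (m : ℕ) → let n = suc (suc m) in
    ∀ (c : Arc n → Fin 4) →
    (∀ t → IsDirected2Factor n (ColourClass c t)) →
    (∀ (j : Fin 3) → IsType1 n (ColourClass c (inject₁ j))) →
    IsType0 n (ColourClass c (fromℕ 3)) →
    (∀ (j : Fin 3) → c (inner zero j) ≡ inject₁ j) →
    ∀ (k : Fin n → Fin 3 → Fin 3) →
    (∀ i j → c (inner i (k i j)) ≡ inject₁ j) →
    ∀ (σ : Fin n → Fin 3 → Fin 3) →
    (∀ i j → σ i (k i j) ≡ k (sucMod i) j) →
    ∀ (x : Fin 3) → applyProduct σ x ≡ x
corollary6p14 m c _ type1 _ arc-at-zero k arc-k σ σ-intertwines x =
  subst (λ y → applyProduct σ y ≡ y) k₀x≡x (applyProduct-intertwines k σ σ-intertwines x)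
  where
    k₀x≡x : k zero x ≡ x
    k₀x≡x = ExactlyOne-unique (type1 x zero) (arc-k zero x) (arc-at-zero x)
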